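{- Let $G$ be a $(k,t)$-regular graph and let $x,y,z$ be three distinct vertices of $G$ such that $y,z\in N(x)$ and $N(x)\subseteq N(y)\cup N(z)$. Then $$N(y)-N(x)=N(z)-N(x),\quad N(x)-N(y)=N(z)-N(y),\quad N(x)-N(z)=N(y)-N(z),$$ where $-$ denotes set difference and $N(v)$ is the neighbourhood of $v$.
   Context: All graphs are simple, possibly infinite, but with finite valency. For a vertex $v$ of a graph $G$, the local graph $G_v$ is the subgraph of $G$ induced on the neighbourhood $N(v)$. A graph $G$ is $(k,t)$-regular if it is $k$-regular and every local graph $G_v$ is $t$-regular. -}

module Defs where

open import Level using (Level; _⊔_; suc)
open import Data.Nat using (ℕ)
open import Data.List using (List; length)
open import Data.List.Membership.Propositional using (_∈_)
open import Data.List.Relation.Unary.Unique.Propositional using (Unique)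
open import Data.Product using (Σ; _×_)
open import Relation.Nullary using (¬_)
open import Relation.Binary.PropositionalEquality using (_≡_)
open import Function.Bundles using (_⇔_)

record Graph (a b : Level) : Set (suc (a ⊔ b)) where
  field
    Vertex : Set a
    Adj    : Vertex → Vertex → Set b
    sym    : ∀ {u v} → Adj u v → Adj v u
    irrefl : ∀ {v} → ¬ Adj v v

module _ {a b : Level} (G : Graph a b) where
  open Graph G

  N : Vertex → Vertex → Set b
  N v u = Adj v u

  HasSize : ∀ {p} → (Vertex → Set p) → ℕ → Set (a ⊔ p)
  HasSize P n = Σ (List Vertex) λ xs →
    Unique xs × length xs ≡ n × (∀ u → (u ∈ xs) ⇔ P u)

  IsRegular : ℕ → Set (a ⊔ b)
  IsRegular k = ∀ v → HasSize (N v) k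

  -- Local graph G_v is t-regular: every vertex u of G_v (i.e. u ∈ N(v))
  -- has exactly t neighbours inside N(v).
  LocalRegular : Vertex → ℕ → Set (a ⊔ b)
  LocalRegular v t = ∀ u → N v u → HasSize (λ w → N v w × N u w) t

  IsKTRegular : ℕ → ℕ → Set (a ⊔ b)
  IsKTRegular k t = IsRegular k × (∀ v → LocalRegular v t)

  SameDiff : Vertex → Vertex → Vertex → Set (a ⊔ b)
  SameDiff p q c = ∀ u → (N p u × ¬ N c u) ⇔ (N q u × ¬ N c u)

{-# OPTIONS --safe #-}
-- The vertices x, y, z form a triangle, as y ∈ N(x) ⊆ N(y) ∪ N(z) forces y ∈ N(z).
-- By inclusion–exclusion inside N(v), for each vertex v of the triangle and its
-- two partners p, q,  |N(v) ∩ (N(p) ∪ N(q))| + |N(x) ∩ N(y) ∩ N(z)| = 2t,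
-- since local t-regularity gives |N(v) ∩ N(p)| = |N(v) ∩ N(q)| = t.  The
-- hypothesis makes the union term equal to k for v = x, hence it equals k for
-- v = y and v = z too, i.e. N(y) ⊆ N(x) ∪ N(z) and N(z) ⊆ N(x) ∪ N(y).  The
-- three pairwise coverings give the three equalities of differences.
module Submission where

open import Defs
open import Level using (Level)
open import Data.Nat using (ℕ; suc; _+_)
open import Data.Nat.Properties using (+-suc; +-assoc; +-comm; +-identityʳ; +-cancelˡ-≡; +-cancelʳ-≡)
open import Data.Product as Product using (_×_; _,_; proj₁; proj₂; ∃₂)
open import Data.Sum as Sum using (_⊎_; inj₁; inj₂; [_,_]′; swap)
open import Data.Empty using (⊥-elim)
open import Data.List using (List; []; _∷_; length; _++_; lookup)
open import Data.List.Properties using (length-++)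
open import Data.List.Membership.Propositional using (_∈_)
open import Data.List.Membership.Propositional.Properties using (∈-++⁻; ∈-++⁺ˡ; ∈-++⁺ʳ)
open import Data.List.Membership.Propositional.Properties.WithK using (unique⇒irrelevant; unique∧set⇒bag)
open import Data.List.Relation.Unary.All as All using (All; []; _∷_)
open import Data.List.Relation.Unary.AllPairs using ([]; _∷_)
open import Data.List.Relation.Unary.Any using (here; there; index; toSum; fromSum)
open import Data.List.Relation.Unary.Any.Properties using (lookup-index)
open import Data.List.Relation.Unary.Unique.Propositional using (Unique)
import Data.List.Relation.Unary.Unique.Propositional.Properties as Unique
open import Data.List.Relation.Binary.BagAndSetEquality using (∼bag⇒↭)
open import Data.List.Relation.Binary.Permutation.Propositional.Properties using (↭-length)
open import Data.List.Relation.Binary.Subset.Propositional using () renaming (_⊆_ to _⊆ˡ_)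
import Data.Fin as Fin
open import Relation.Nullary using (¬_; Dec; yes; no; ¬?)
open import Relation.Nullary.Decidable as Dec using (map′; _⊎-dec_; decidable-stable)
open import Relation.Unary using (Pred; Empty; _∩_; _∪_; _∖_; _⊆_; _≐_; _⊥_)
open import Relation.Binary.PropositionalEquality using (_≡_; refl; sym; trans; cong; subst; module ≡-Reasoning)
open import Function.Base using (_∘_)
open import Function.Bundles using (mk⇔; Equivalence)
open Equivalence using (to; from)
open ≡-Reasoning

disjunctive-syllogism : ∀ {a b} {A : Set a} {B : Set b} → A ⊎ B → ¬ A → B
disjunctive-syllogism (inj₁ a) ¬a = ⊥-elim (¬a a)
disjunctive-syllogism (inj₂ b) _  = b

module _ {a} {A : Set a} where

  -- A has no decidable equality, but members of a duplicate-free list are equal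
  -- exactly when their positions are.
  ≟-unique : ∀ {xs : List A} {u w} → Unique xs → u ∈ xs → w ∈ xs → Dec (u ≡ w)
  ≟-unique {xs} {u} {w} xs! u∈ w∈ =
    map′ same-position (λ { refl → cong index (unique⇒irrelevant xs! u∈ w∈) })
         (index u∈ Fin.≟ index w∈)
    where
    same-position : index u∈ ≡ index w∈ → u ≡ w
    same-position i≡j = begin
      u                    ≡⟨ lookup-index u∈ ⟩
      lookup xs (index u∈) ≡⟨ cong (lookup xs) i≡j ⟩
      lookup xs (index w∈) ≡⟨ sym (lookup-index w∈) ⟩
      w                    ∎

  ∈?-⊆-unique : ∀ {xs} ys {u} → Unique xs → ys ⊆ˡ xs → u ∈ xs → Dec (u ∈ ys)
  ∈?-⊆-unique []       _   _     _  = no λ ()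
  ∈?-⊆-unique (y ∷ ys) xs! ys⊆xs u∈ =
    map′ fromSum toSum
      (≟-unique xs! u∈ (ys⊆xs (here refl)) ⊎-dec ∈?-⊆-unique ys xs! (ys⊆xs ∘ there) u∈)

  module _ {p} {P : Pred A p} where

    -- Unlike stdlib's filter, P need only be decided on the members of the list.
    filter-with : ∀ {xs} → All (Dec ∘ P) xs → List A
    filter-with []                    = []
    filter-with {x ∷ _} (yes _ ∷ ds) = x ∷ filter-with ds
    filter-with         (no _  ∷ ds) = filter-with ds

    ∈-filter-with⁻ : ∀ {xs} (ds : All (Dec ∘ P) xs) {u} → u ∈ filter-with ds → u ∈ xs × P u
    ∈-filter-with⁻ (yes px ∷ ds) (here refl) = here refl , px
    ∈-filter-with⁻ (yes _  ∷ ds) (there u∈)  = Product.map₁ there (∈-filter-with⁻ ds u∈)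
    ∈-filter-with⁻ (no _   ∷ ds) u∈          = Product.map₁ there (∈-filter-with⁻ ds u∈)

    ∈-filter-with⁺ : ∀ {xs} (ds : All (Dec ∘ P) xs) {u} → u ∈ xs → P u → u ∈ filter-with ds
    ∈-filter-with⁺ (yes _   ∷ ds) (here refl) _  = here refl
    ∈-filter-with⁺ (no ¬px  ∷ ds) (here refl) px = ⊥-elim (¬px px)
    ∈-filter-with⁺ (yes _   ∷ ds) (there u∈)  pu = there (∈-filter-with⁺ ds u∈ pu)
    ∈-filter-with⁺ (no _    ∷ ds) (there u∈)  pu = ∈-filter-with⁺ ds u∈ pu

    filter-with-unique : ∀ {xs} (ds : All (Dec ∘ P) xs) → Unique xs → Unique (filter-with ds)
    filter-with-unique []            []          = []
    filter-with-unique (yes _ ∷ ds) (x∉ ∷ xs!) =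
      All.tabulate (All.lookup x∉ ∘ proj₁ ∘ ∈-filter-with⁻ ds) ∷ filter-with-unique ds xs!
    filter-with-unique (no _  ∷ ds) (_  ∷ xs!) = filter-with-unique ds xs!

  length-filter-with : ∀ {p} {P : Pred A p} {xs} (ds : All (Dec ∘ P) xs) →
    length (filter-with ds) + length (filter-with (All.map ¬? ds)) ≡ length xs
  length-filter-with []           = refl
  length-filter-with (yes _ ∷ ds) = cong suc (length-filter-with ds)
  length-filter-with (no _  ∷ ds) = trans (+-suc _ _) (cong suc (length-filter-with ds))

module _ {a b} (G : Graph a b) where
  open Graph G using (Vertex)

  private variable
    p q r : Level
    P : Pred Vertex p
    Q : Pred Vertex q
    R : Pred Vertex r
    i j m n : ℕ

  HasSize-cong : P ≐ Q → HasSize G P n → HasSize G Q n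
  HasSize-cong (P⊆Q , Q⊆P) (xs , xs! , |xs| , xs≐P) =
    xs , xs! , |xs| , λ u → mk⇔ (P⊆Q ∘ to (xs≐P u)) (from (xs≐P u) ∘ Q⊆P)

  HasSize-functional : HasSize G P m → HasSize G P n → m ≡ n
  HasSize-functional (xs , xs! , refl , xs≐P) (ys , ys! , refl , ys≐P) =
    ↭-length (∼bag⇒↭ (unique∧set⇒bag xs! ys!
      (mk⇔ (from (ys≐P _) ∘ to (xs≐P _)) (from (xs≐P _) ∘ to (ys≐P _)))))

  HasSize-0⇒Empty : HasSize G P 0 → Empty P
  HasSize-0⇒Empty ([] , _ , _ , []≐P) u Pu with () ← from ([]≐P u) Pu

  HasSize-∪ : P ⊥ Q → HasSize G P m → HasSize G Q n → HasSize G (P ∪ Q) (m + n)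
  HasSize-∪ P⊥Q (xs , xs! , refl , xs≐P) (ys , ys! , refl , ys≐Q) =
    xs ++ ys ,
    Unique.++⁺ xs! ys! (λ (u∈xs , u∈ys) → P⊥Q (to (xs≐P _) u∈xs , to (ys≐Q _) u∈ys)) ,
    length-++ xs ,
    λ u → mk⇔ (Sum.map (to (xs≐P u)) (to (ys≐Q u)) ∘ ∈-++⁻ xs)
              [ ∈-++⁺ˡ ∘ from (xs≐P u) , ∈-++⁺ʳ xs ∘ from (ys≐Q u) ]′

  HasSize-dec : HasSize G P n → HasSize G (P ∩ Q) m → ∀ {u} → P u → Dec (Q u)
  HasSize-dec (xs , xs! , _ , xs≐P) (ys , _ , _ , ys≐P∩Q) {u} Pu =
    map′ (proj₂ ∘ to (ys≐P∩Q u)) (λ Qu → from (ys≐P∩Q u) (Pu , Qu))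
      (∈?-⊆-unique ys xs! (from (xs≐P _) ∘ proj₁ ∘ to (ys≐P∩Q _)) (from (xs≐P u) Pu))

  HasSize-split : HasSize G P n → (∀ {u} → P u → Dec (Q u)) →
    ∃₂ λ i j → HasSize G (P ∩ Q) i × HasSize G (P ∖ Q) j × i + j ≡ n
  HasSize-split {P = P} {Q = Q} (xs , xs! , refl , xs≐P) Q? =
    _ , _ , restrict ds , restrict (All.map ¬? ds) , length-filter-with ds
    where
    ds : All (Dec ∘ Q) xs
    ds = All.tabulate (Q? ∘ to (xs≐P _))
    restrict : ∀ {r} {R : Pred Vertex r} (rs : All (Dec ∘ R) xs) →
      HasSize G (P ∩ R) (length (filter-with rs))
    restrict rs = filter-with rs , filter-with-unique rs xs! , refl , λ u → mk⇔
      (Product.map₁ (to (xs≐P u)) ∘ ∈-filter-with⁻ rs)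
      (λ (Pu , Ru) → ∈-filter-with⁺ rs (from (xs≐P u) Pu) Ru)

  HasSize-∩⇒Empty-∖ : HasSize G P n → HasSize G (P ∩ Q) n → Empty (P ∖ Q)
  HasSize-∩⇒Empty-∖ {P = P} {n = n} {Q = Q} sP sP∩Q u P∖Qu
    with HasSize-split sP (HasSize-dec sP sP∩Q)
  ... | i , j , sP∩Q′ , sP∖Q , i+j≡n =
    HasSize-0⇒Empty (subst (HasSize G (P ∖ Q)) j≡0 sP∖Q) u P∖Qu
    where
    j≡0 : j ≡ 0
    j≡0 = +-cancelˡ-≡ n j 0 (begin
      n + j ≡⟨ cong (_+ j) (HasSize-functional sP∩Q sP∩Q′) ⟩
      i + j ≡⟨ i+j≡n ⟩
      n     ≡⟨ +-identityʳ n ⟨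
      n + 0 ∎)

  HasSize-⊆⇒⊇ : HasSize G P n → HasSize G Q n → Q ⊆ P → P ⊆ Q
  HasSize-⊆⇒⊇ {P = P} {n = n} {Q = Q} sP sQ Q⊆P Pu =
    decidable-stable (HasSize-dec sP sP∩Q Pu) (λ ¬Qu → HasSize-∩⇒Empty-∖ sP sP∩Q _ (Pu , ¬Qu))
    where
    sP∩Q : HasSize G (P ∩ Q) n
    sP∩Q = HasSize-cong ((λ Qu → Q⊆P Qu , Qu) , proj₂) sQ

  HasSize-∪+∩ : HasSize G P n → HasSize G (P ∩ Q) i → HasSize G (P ∩ R) j →
    ∃₂ λ m c → HasSize G (P ∩ (Q ∪ R)) m × HasSize G (P ∩ Q ∩ R) c × m + c ≡ i + j
  HasSize-∪+∩ {P = P} {Q = Q} {i = i} {R = R} {j = j} sP sP∩Q sP∩R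
    with HasSize-split sP∩R (HasSize-dec sP sP∩Q ∘ proj₁)
  ... | c , d , sP∩R∩Q , sP∩R∖Q , c+d≡j =
    i + d , c ,
    HasSize-cong union (HasSize-∪ (λ ((_ , Qu) , (_ , ¬Qu)) → ¬Qu Qu) sP∩Q sP∩R∖Q) ,
    HasSize-cong ((λ ((Pu , Ru) , Qu) → Pu , Qu , Ru) , (λ (Pu , Qu , Ru) → (Pu , Ru) , Qu)) sP∩R∩Q ,
    (begin
      i + d + c   ≡⟨ +-assoc i d c ⟩
      i + (d + c) ≡⟨ cong (i +_) (+-comm d c) ⟩
      i + (c + d) ≡⟨ cong (i +_) c+d≡j ⟩
      i + j       ∎)
    where
    union : (P ∩ Q) ∪ ((P ∩ R) ∖ Q) ≐ P ∩ (Q ∪ R)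
    union = [ Product.map₂ inj₁ , Product.map₂ inj₂ ∘ proj₁ ]′ , λ where
      (Pu , inj₁ Qu) → inj₁ (Pu , Qu)
      (Pu , inj₂ Ru) → Sum.map (Pu ,_) ((Pu , Ru) ,_) (Dec.toSum (HasSize-dec sP sP∩Q Pu))

  ⊆-∪⇒SameDiff : ∀ {p q c : Vertex} →
    N G p ⊆ N G c ∪ N G q → N G q ⊆ N G c ∪ N G p → SameDiff G p q c
  ⊆-∪⇒SameDiff Np⊆ Nq⊆ u = mk⇔
    (λ (Npu , ¬Ncu) → disjunctive-syllogism (Np⊆ Npu) ¬Ncu , ¬Ncu)
    (λ (Nqu , ¬Ncu) → disjunctive-syllogism (Nq⊆ Nqu) ¬Ncu , ¬Ncu)

module _ {a b} (G : Graph a b) (k t : ℕ) (regular : IsKTRegular G k t) where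
  open Graph G using (Adj) renaming (sym to Adj-sym)

  neighbourhoods-∪+∩ : ∀ {v p q} → Adj v p → Adj v q →
    ∃₂ λ m c → HasSize G (N G v ∩ (N G p ∪ N G q)) m ×
               HasSize G (N G v ∩ N G p ∩ N G q) c × m + c ≡ t + t
  neighbourhoods-∪+∩ {v} {p} {q} vp vq =
    HasSize-∪+∩ G (proj₁ regular v) (proj₂ regular v p vp) (proj₂ regular v q vq)

  ⊆-∪-rotate : ∀ {x y z} → Adj x y → Adj x z → Adj y z →
    N G x ⊆ N G y ∪ N G z → N G y ⊆ N G x ∪ N G z
  ⊆-∪-rotate {x} {y} {z} xy xz yz Nx⊆
    with neighbourhoods-∪+∩ xy xz | neighbourhoods-∪+∩ (Adj-sym xy) yz
  ... | mx , cx , sUx , sTx , mx+cx≡2t | my , cy , sUy , sTy , my+cy≡2t =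
    λ Nyu → proj₂ (HasSize-⊆⇒⊇ G (proj₁ regular y) (subst (HasSize G _) my≡k sUy) proj₁ Nyu)
    where
    mx≡k : mx ≡ k
    mx≡k = HasSize-functional G sUx
             (HasSize-cong G ((λ Nxu → Nxu , Nx⊆ Nxu) , proj₁) (proj₁ regular x))
    cy≡cx : cy ≡ cx
    cy≡cx = HasSize-functional G sTy
              (HasSize-cong G ((λ (Nxu , Nyu , Nzu) → Nyu , Nxu , Nzu) , (λ (Nyu , Nxu , Nzu) → Nxu , Nyu , Nzu)) sTx)
    my≡k : my ≡ k
    my≡k = +-cancelʳ-≡ cx my k (begin
      my + cx ≡⟨ cong (my +_) cy≡cx ⟨
      my + cy ≡⟨ my+cy≡2t ⟩
      t + t   ≡⟨ mx+cx≡2t ⟨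
      mx + cx ≡⟨ cong (_+ cx) mx≡k ⟩
      k + cx  ∎)

corollary4p2 : ∀ {a b : Level} (G : Graph a b) (k t : ℕ) →
    IsKTRegular G k t →
    (x y z : Graph.Vertex G) →
    ¬ x ≡ y → ¬ x ≡ z → ¬ y ≡ z →
    N G x y → N G x z →
    (∀ u → N G x u → N G y u ⊎ N G z u) →
    SameDiff G y z x × SameDiff G x z y × SameDiff G x y z
corollary4p2 G k t regular x y z _ _ _ xy xz Nx⊆′ =
  ⊆-∪⇒SameDiff G Ny⊆ Nz⊆ ,
  ⊆-∪⇒SameDiff G Nx⊆ (λ Nzu → swap (Nz⊆ Nzu)) ,
  ⊆-∪⇒SameDiff G (λ Nxu → swap (Nx⊆ Nxu)) (λ Nyu → swap (Ny⊆ Nyu))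
  where
  open Graph G using (irrefl) renaming (sym to Adj-sym)
  Nx⊆ : N G x ⊆ N G y ∪ N G z
  Nx⊆ = Nx⊆′ _
  yz : N G y z
  yz = Adj-sym (disjunctive-syllogism (Nx⊆ xy) irrefl)
  Ny⊆ : N G y ⊆ N G x ∪ N G z
  Ny⊆ = ⊆-∪-rotate G k t regular xy xz yz Nx⊆
  Nz⊆ : N G z ⊆ N G x ∪ N G y
  Nz⊆ = ⊆-∪-rotate G k t regular xz xy (Adj-sym yz) (λ Nxu → swap (Nx⊆ Nxu))
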